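{- Let $I$ be a yes-instance of \textsc{Stars NWS}. Then for every optimal solution $G'=(V,E')$ of $I$ there is an edge set $E^*\subseteq E'$ with $|E^*|\le 4t$ such that the edge set of every local cycle of $G'$ is a subset of $E^*$.
   Context: \textsc{Stars NWS}: given a graph $G=(V,E)$ with $n$ vertices, a collection $\mathcal{C}$ of subsets of $V$ (communities), $\omega:E\to\mathbb{R}_+$, an integer $\ell$ and a positive real $b$, a solution is a spanning subgraph $G'=(V,E')$ with $E'\subseteq E$, $|E'|\le\ell$, $\omega(E')\le b$, such that for each $C\in\mathcal{C}$ the set $\mathrm{univ}_{G'}(C)$ of vertices $u\in C$ adjacent in $G'$ to all of $C\setminus\{u\}$ is nonempty. An optimal solution is a solution with the minimum number of edges. The parameter is $t=\ell-n+x$ where $x$ is the number of connected components of the hypergraph $(V,\mathcal{C})$. Two distinct communities $C_1,C_2$ induce a local cycle in $G'$ if there are $c_i\in\mathrm{univ}_{G'}(C_i)$ ($i=1,2$) such that the graph on $C_1\cup C_2$ with edge set $\{\{c_i,w\}: w\in C_i\setminus\{c_i\}, i\in\{1,2\}\}$ contains a cycle; each cycle of this graph is a local cycle of $G'$.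
   Formalization: The edge weights ω and the budget b take values in the positive rationals instead of the positive reals. -}

module Defs where

import Data.Nat
open import Data.Nat using (ℕ)
open import Data.Fin using (Fin; _<_)
open import Data.Fin.Subset using (Subset; _∈_; _∉_)
open import Data.Product using (Σ; ∃; ∃-syntax; _×_; _,_)
open import Data.Sum using (_⊎_)
open import Data.List using (List; []; _∷_; length; map; sum; foldr)
open import Data.List.Relation.Unary.All using (All)
open import Data.List.Relation.Unary.Unique.Propositional using (Unique)
import Data.List.Membership.Propositional as L
open import Data.Rational using (ℚ; 0ℚ) renaming (_+_ to _+ℚ_; _≤_ to _≤ℚ_; _<_ to _<ℚ_)
open import Relation.Binary.PropositionalEquality using (_≡_; _≢_)
open import Function.Bundles using (Surjection)
open import Relation.Binary.PropositionalEquality using (setoid)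
open import Function using (_⇔_)
open import Level using (0ℓ)

-- An edge of a simple graph on vertex set Fin n is stored canonically
-- as an ordered pair (u , v) with u < v.
Edge : ℕ → Set
Edge n = Fin n × Fin n

Canonical : ∀ {n} → Edge n → Set
Canonical (u , v) = u < v

Adj : ∀ {n} → List (Edge n) → Fin n → Fin n → Set
Adj F u v = ((u , v) L.∈ F) ⊎ ((v , u) L.∈ F)

_⊆E_ : ∀ {n} → List (Edge n) → List (Edge n) → Set
F ⊆E H = All (λ e → e L.∈ H) F

record Graph (n : ℕ) : Set where
  field
    E         : List (Edge n)
    canonical : All Canonical E
    noDup     : Unique E

weight : ∀ {n} → (Edge n → ℚ) → List (Edge n) → ℚ
weight ω F = foldr (λ e acc → ω e +ℚ acc) 0ℚ F

Univ : ∀ {n} → List (Edge n) → Subset n → Fin n → Set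
Univ F C u = u ∈ C × (∀ w → w ∈ C → w ≢ u → Adj F u w)

IsSolution : ∀ {n} (G : Graph n) (𝒞 : List (Subset n)) (ω : Edge n → ℚ)
             (ℓ : ℕ) (b : ℚ) → List (Edge n) → Set
IsSolution G 𝒞 ω ℓ b F =
  F ⊆E Graph.E G × Unique F × length F Data.Nat.≤ ℓ × weight ω F ≤ℚ b ×
  All (λ C → ∃[ u ] Univ F C u) 𝒞

IsOptimal : ∀ {n} (G : Graph n) (𝒞 : List (Subset n)) (ω : Edge n → ℚ)
            (ℓ : ℕ) (b : ℚ) → List (Edge n) → Set
IsOptimal G 𝒞 ω ℓ b F =
  IsSolution G 𝒞 ω ℓ b F ×
  (∀ F′ → IsSolution G 𝒞 ω ℓ b F′ → length F Data.Nat.≤ length F′)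

IsYes : ∀ {n} (G : Graph n) (𝒞 : List (Subset n)) (ω : Edge n → ℚ)
        (ℓ : ℕ) (b : ℚ) → Set
IsYes G 𝒞 ω ℓ b = ∃[ F ] IsSolution G 𝒞 ω ℓ b F

data HConn {n} (𝒞 : List (Subset n)) : Fin n → Fin n → Set where
  here : ∀ {u} → HConn 𝒞 u u
  step : ∀ {u w v} (C : Subset n) → C L.∈ 𝒞 → u ∈ C → w ∈ C →
         HConn 𝒞 w v → HConn 𝒞 u v

NumComponents : ∀ {n} → List (Subset n) → ℕ → Set
NumComponents {n} 𝒞 x =
  Σ (Fin n → Fin x) λ f →
    (∀ y → ∃[ v ] f v ≡ y) × (∀ u v → (f u ≡ f v) ⇔ HConn 𝒞 u v)

StarEdge : ∀ {n} → Subset n → Fin n → Fin n → Fin n → Set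
StarEdge C c a b = (a ≡ c × b ∈ C × b ≢ c) ⊎ (b ≡ c × a ∈ C × a ≢ c)

HEdge : ∀ {n} → Subset n → Fin n → Subset n → Fin n → Fin n → Fin n → Set
HEdge C₁ c₁ C₂ c₂ a b = StarEdge C₁ c₁ a b ⊎ StarEdge C₂ c₂ a b

-- consecutive pairs of a closed vertex sequence v₀ … v_{k-1} (including v_{k-1}v₀)
cyclePairs : ∀ {A : Set} → List A → List (A × A)
cyclePairs []       = []
cyclePairs (x ∷ xs) = go x (x ∷ xs)
  where
  go : _ → List _ → List (_ × _)
  go x₀ []           = []
  go x₀ (y ∷ [])     = (y , x₀) ∷ []
  go x₀ (y ∷ z ∷ zs) = (y , z) ∷ go x₀ (z ∷ zs)

IsCycle : ∀ {n} → (Fin n → Fin n → Set) → List (Fin n) → Set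
IsCycle R vs = 3 Data.Nat.≤ length vs × Unique vs ×
               All (λ p → R (Data.Product.proj₁ p) (Data.Product.proj₂ p)) (cyclePairs vs)

IsLocalCycle : ∀ {n} → List (Subset n) → List (Edge n) → List (Fin n) → Set
IsLocalCycle 𝒞 F vs =
  ∃[ C₁ ] ∃[ C₂ ] ∃[ c₁ ] ∃[ c₂ ]
    C₁ L.∈ 𝒞 × C₂ L.∈ 𝒞 × C₁ ≢ C₂ × Univ F C₁ c₁ × Univ F C₂ c₂ ×
    IsCycle (HEdge C₁ c₁ C₂ c₂) vs

CycleEdgesIn : ∀ {n} → List (Edge n) → List (Fin n) → Set
CycleEdgesIn F vs = All (λ p → Adj F (Data.Product.proj₁ p) (Data.Product.proj₂ p)) (cyclePairs vs)

-- The auxiliary graph of a local cycle is a union of two stars, so each of its edges has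
-- an endpoint in {c₁, c₂}; hence its cycles have at most four vertices, and every edge of a
-- local cycle lies on a cycle of length at most four in G′.  Such edges are collected
-- greedily: whenever an edge e of G′ joins the ends of a walk of length at most three in
-- G′ − e, add e together with that walk.  Each batch has at most four edges and closes a
-- cycle, so it raises the cyclomatic number |S| − n + #components(S) of the collected set S.
-- Since G′ contains a spanning star of every community, it has at most x components, so
-- every subset of E′ has cyclomatic number at most |E′| − n + x ≤ t: at most 4t edges are
-- collected.

module Submission where

open import Defs
open import Data.Nat using (ℕ; zero; suc)
open import Data.Fin using (Fin; _≟_; toℕ; #_)
open import Data.Fin.Properties using (any?; toℕ≤pred[n])
open import Data.Fin.Subset using (Subset) renaming (_∈_ to _∈ˢ_)
open import Data.Product using (Σ-syntax; ∃-syntax; _×_; _,_; proj₁; proj₂)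
open import Data.Product.Properties using (≡-dec)
open import Data.Sum using (_⊎_; inj₁; inj₂; [_,_])
import Data.Sum as Sum
open import Data.Empty using (⊥; ⊥-elim)
open import Data.List using (List; []; _∷_; length; filter; allFin; map; foldr)
open import Data.List.Properties using (filter-notAll; length-map; length-tabulate)
open import Data.List.Relation.Unary.All as All using (All; []; _∷_)
open import Data.List.Relation.Unary.All.Properties using (¬Any⇒All¬)
open import Data.List.Relation.Unary.Any as Any using (here; there)
open import Data.List.Relation.Unary.AllPairs using ([]; _∷_)
open import Data.List.Relation.Unary.Unique.Propositional using (Unique)
open import Data.List.Relation.Unary.Unique.Propositional.Properties using (allFin⁺; filter⁺)
open import Data.List.Membership.Propositional using (_∈_; _∉_)
open import Data.List.Membership.Propositional.Properties
  using (∈-filter⁺; ∈-filter⁻; ∈-allFin; ∈-map⁺)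
open import Function using (id; _∘_)
open import Function.Bundles using (Equivalence)
open import Relation.Nullary using (Dec; yes; no; contradiction)
open import Relation.Nullary.Decidable using (map′; _×-dec_; _⊎-dec_; ¬?)
open import Relation.Binary.Definitions using (DecidableEquality)
open import Relation.Binary.PropositionalEquality
  using (_≡_; _≢_; refl; sym; trans; cong; cong₂; subst; ≢-sym)

-- ℕ arithmetic is opened only inside the modules below: the statement at the end
-- uses the integer operators of the same names.

module _ {A : Set} (_≟ᴬ_ : DecidableEquality A) where
  open import Data.Nat using (_≤_; z≤n)
  open import Data.Nat.Properties using (module ≤-Reasoning)
  open ≤-Reasoning

  Unique⇒length≤ : ∀ {xs ys : List A} → Unique xs → (∀ {x} → x ∈ xs → x ∈ ys) →
                   length xs ≤ length ys
  Unique⇒length≤ {[]} _ _ = z≤n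
  Unique⇒length≤ {x ∷ xs} {ys} (x∉xs ∷ xs-unique) x∷xs⊆ys = begin-strict
    length xs   ≤⟨ Unique⇒length≤ xs-unique xs⊆ys∖x ⟩
    length ys∖x <⟨ filter-notAll (¬? ∘ (x ≟ᴬ_)) ys (Any.map (λ x≡y x≢y → x≢y x≡y) x∈ys) ⟩
    length ys   ∎
    where
    ys∖x : List A
    ys∖x = filter (¬? ∘ (x ≟ᴬ_)) ys
    x∈ys : x ∈ ys
    x∈ys = x∷xs⊆ys (here refl)
    xs⊆ys∖x : ∀ {y} → y ∈ xs → y ∈ ys∖x
    xs⊆ys∖x y∈xs = ∈-filter⁺ (¬? ∘ (x ≟ᴬ_)) (x∷xs⊆ys (there y∈xs)) (All.lookup x∉xs y∈xs)

module _ {n : ℕ} where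
  open import Data.Nat using (_+_; _*_; _≤_; z≤n; s≤s)
  open import Data.Nat.Properties
    using (≤-refl; ≤-reflexive; ≤-trans; n≤1+n; m≤m+n; +-suc; +-assoc; +-comm; *-suc;
           +-mono-≤; +-monoˡ-≤; +-monoʳ-≤; *-monoʳ-≤; module ≤-Reasoning)
  open ≤-Reasoning

  redirect : Fin n → Fin n → Fin n → Fin n
  redirect t u y with y ≟ u
  ... | yes _ = t
  ... | no  _ = y

  redirect-hit : ∀ t u → redirect t u u ≡ t
  redirect-hit t u with u ≟ u
  ... | yes _  = refl
  ... | no u≢u = contradiction refl u≢u

  redirect-miss : ∀ t {u y} → y ≢ u → redirect t u y ≡ y
  redirect-miss t {u} {y} y≢u with y ≟ u
  ... | yes y≡u = contradiction y≡u y≢u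
  ... | no  _   = refl

  redirect-self : ∀ t u → redirect t u t ≡ t
  redirect-self t u with t ≟ u
  ... | yes _ = refl
  ... | no  _ = refl

  redirect-idle : ∀ t y → redirect t t y ≡ y
  redirect-idle t y with y ≟ t
  ... | yes y≡t = sym y≡t
  ... | no  _   = refl

  relabel : Edge n → (Fin n → Fin n) → Fin n → Fin n
  relabel (a , b) lab w = redirect (lab a) (lab b) (lab w)

  relabel-joins : ∀ a b lab → relabel (a , b) lab a ≡ relabel (a , b) lab b
  relabel-joins a b lab = trans (redirect-self (lab a) (lab b)) (sym (redirect-hit (lab a) (lab b)))

  -- A union–find labelling of the components of (Fin n, S): its roots are one
  -- vertex per component, so potential S is n plus the cyclomatic number of S.
  labelling : List (Edge n) → Fin n → Fin n
  labelling = foldr relabel id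

  roots : (Fin n → Fin n) → List (Fin n)
  roots lab = filter (λ w → lab w ≟ w) (allFin n)

  potential : List (Edge n) → ℕ
  potential S = length (roots (labelling S)) + length S

  labelling-∈ : ∀ {S a b} → (a , b) ∈ S → labelling S a ≡ labelling S b
  labelling-∈ {(a , b) ∷ S} (here refl) = relabel-joins a b (labelling S)
  labelling-∈ {(c , d) ∷ S} (there ab∈S) =
    cong (redirect (labelling S c) (labelling S d)) (labelling-∈ ab∈S)

  labelling-Adj : ∀ {S a b} → Adj S a b → labelling S a ≡ labelling S b
  labelling-Adj (inj₁ ab∈S) = labelling-∈ ab∈S
  labelling-Adj (inj₂ ba∈S) = sym (labelling-∈ ba∈S)

  ∈-roots⁺ : ∀ {lab w} → lab w ≡ w → w ∈ roots lab
  ∈-roots⁺ {lab} {w} = ∈-filter⁺ (λ v → lab v ≟ v) (∈-allFin w)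

  ∈-roots⁻ : ∀ {lab w} → w ∈ roots lab → lab w ≡ w
  ∈-roots⁻ {lab} w∈roots = proj₂ (∈-filter⁻ (λ v → lab v ≟ v) {xs = allFin n} w∈roots)

  roots-unique : ∀ lab → Unique (roots lab)
  roots-unique lab = filter⁺ (λ v → lab v ≟ v) (allFin⁺ n)

  length-roots-id : n ≤ length (roots id)
  length-roots-id = begin
    n                   ≡⟨ length-tabulate id ⟨
    length (allFin n)   ≤⟨ Unique⇒length≤ _≟_ (allFin⁺ n) (λ _ → ∈-roots⁺ refl) ⟩
    length (roots id)   ∎

  length-roots-relabel : ∀ a b lab →
                         length (roots lab) ≤ suc (length (roots (relabel (a , b) lab)))
  length-roots-relabel a b lab = Unique⇒length≤ _≟_ (roots-unique lab) root-survives
    where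
    root-survives : ∀ {w} → w ∈ roots lab → w ∈ lab b ∷ roots (relabel (a , b) lab)
    root-survives {w} w∈roots with w ≟ lab b
    ... | yes refl = here refl
    ... | no  w≢lab-b = there (∈-roots⁺ (trans (redirect-miss (lab a) lab-w≢lab-b) lab-w≡w))
      where
      lab-w≡w : lab w ≡ w
      lab-w≡w = ∈-roots⁻ w∈roots
      lab-w≢lab-b : lab w ≢ lab b
      lab-w≢lab-b lab-w≡lab-b = w≢lab-b (trans (sym lab-w≡w) lab-w≡lab-b)

  length-roots-relabel-joined : ∀ {a b lab} → lab a ≡ lab b →
                                length (roots lab) ≤ length (roots (relabel (a , b) lab))
  length-roots-relabel-joined {a} {b} {lab} lab-a≡lab-b =
    Unique⇒length≤ _≟_ (roots-unique lab) root-survives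
    where
    root-survives : ∀ {w} → w ∈ roots lab → w ∈ roots (relabel (a , b) lab)
    root-survives {w} w∈roots = ∈-roots⁺ (trans
      (cong (λ t → redirect t (lab b) (lab w)) lab-a≡lab-b)
      (trans (redirect-idle (lab b) (lab w)) (∈-roots⁻ w∈roots)))

  potential-[] : n ≤ potential []
  potential-[] = ≤-trans length-roots-id (m≤m+n _ 0)

  potential-∷ : ∀ g S → potential S ≤ potential (g ∷ S)
  potential-∷ (a , b) S =
    ≤-trans (+-monoˡ-≤ (length S) (length-roots-relabel a b (labelling S)))
            (≤-reflexive (sym (+-suc _ (length S))))

  potential-∷-closing : ∀ {a b} S → labelling S a ≡ labelling S b →
                        suc (potential S) ≤ potential ((a , b) ∷ S)
  potential-∷-closing S joined =
    ≤-trans (s≤s (+-monoˡ-≤ (length S) (length-roots-relabel-joined joined)))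
            (≤-reflexive (sym (+-suc _ (length S))))

  hub-label : ∀ {F C c u} {B : Set} (lab : Fin n → B) → (∀ {a b} → Adj F a b → lab a ≡ lab b) →
              Univ F C c → u ∈ˢ C → lab u ≡ lab c
  hub-label {c = c} {u} lab lab-Adj (_ , c-adj) u∈C with u ≟ c
  ... | yes refl = refl
  ... | no  u≢c  = sym (lab-Adj (c-adj u u∈C u≢c))

  HConn⇒same-label : ∀ {F 𝒞 u v} {B : Set} (lab : Fin n → B) →
                     (∀ {a b} → Adj F a b → lab a ≡ lab b) →
                     All (λ C → ∃[ c ] Univ F C c) 𝒞 → HConn 𝒞 u v → lab u ≡ lab v
  HConn⇒same-label lab lab-Adj hubs here = refl
  HConn⇒same-label lab lab-Adj hubs (step C C∈𝒞 u∈C w∈C w~v) =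
    trans (trans (hub-label lab lab-Adj hub u∈C) (sym (hub-label lab lab-Adj hub w∈C)))
          (HConn⇒same-label lab lab-Adj hubs w~v)
    where
    hub : Univ _ C (proj₁ (All.lookup hubs C∈𝒞))
    hub = proj₂ (All.lookup hubs C∈𝒞)

  length-roots≤ : ∀ {x} lab (f : Fin n → Fin x) → (∀ y → ∃[ v ] f v ≡ y) →
                  (∀ {u v} → f u ≡ f v → lab u ≡ lab v) → length (roots lab) ≤ x
  length-roots≤ {x} lab f f-onto f-respects = begin
    length (roots lab)                     ≤⟨ Unique⇒length≤ _≟_ (roots-unique lab) root-represented ⟩
    length (map representative (allFin x)) ≡⟨ length-map representative (allFin x) ⟩
    length (allFin x)                      ≡⟨ length-tabulate id ⟩
    x                                      ∎
    where
    representative : Fin x → Fin n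
    representative y = lab (proj₁ (f-onto y))
    root-represented : ∀ {w} → w ∈ roots lab → w ∈ map representative (allFin x)
    root-represented {w} w∈roots =
      subst (_∈ map representative (allFin x))
            (trans (f-respects (proj₂ (f-onto (f w)))) (∈-roots⁻ w∈roots))
            (∈-map⁺ representative (∈-allFin (f w)))

  _≟ᴱ_ : DecidableEquality (Edge n)
  _≟ᴱ_ = ≡-dec _≟_ _≟_

  open import Data.List.Membership.DecPropositional _≟ᴱ_ using (_∈?_)

  insert : Edge n → List (Edge n) → List (Edge n)
  insert g S with g ∈? S
  ... | yes _ = S
  ... | no  _ = g ∷ S

  inserts : List (Edge n) → List (Edge n) → List (Edge n)
  inserts T S = foldr insert S T

  ∈-insert⁺ˡ : ∀ g S → g ∈ insert g S
  ∈-insert⁺ˡ g S with g ∈? S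
  ... | yes g∈S = g∈S
  ... | no  _   = here refl

  ∈-insert⁺ʳ : ∀ g {S h} → h ∈ S → h ∈ insert g S
  ∈-insert⁺ʳ g {S} h∈S with g ∈? S
  ... | yes _ = h∈S
  ... | no  _ = there h∈S

  ∈-insert⁻ : ∀ g {S h} → h ∈ insert g S → h ≡ g ⊎ h ∈ S
  ∈-insert⁻ g {S} h∈ with g ∈? S
  ... | yes _ = inj₂ h∈
  ... | no  _ = Any.toSum h∈

  insert-unique : ∀ g {S} → Unique S → Unique (insert g S)
  insert-unique g {S} S-unique with g ∈? S
  ... | yes _   = S-unique
  ... | no  g∉S = ¬Any⇒All¬ S g∉S ∷ S-unique

  length-insert : ∀ g S → length (insert g S) ≤ suc (length S)
  length-insert g S with g ∈? S
  ... | yes _ = n≤1+n (length S)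
  ... | no  _ = ≤-refl

  potential-insert : ∀ g S → potential S ≤ potential (insert g S)
  potential-insert g S with g ∈? S
  ... | yes _ = ≤-refl
  ... | no  _ = potential-∷ g S

  ∈-inserts⁺ˡ : ∀ {T S h} → h ∈ T → h ∈ inserts T S
  ∈-inserts⁺ˡ {g ∷ T} {S} (here refl) = ∈-insert⁺ˡ g (inserts T S)
  ∈-inserts⁺ˡ {g ∷ T}     (there h∈T) = ∈-insert⁺ʳ g (∈-inserts⁺ˡ h∈T)

  ∈-inserts⁺ʳ : ∀ T {S h} → h ∈ S → h ∈ inserts T S
  ∈-inserts⁺ʳ []      h∈S = h∈S
  ∈-inserts⁺ʳ (g ∷ T) h∈S = ∈-insert⁺ʳ g (∈-inserts⁺ʳ T h∈S)

  ∈-inserts⁻ : ∀ T {S h} → h ∈ inserts T S → h ∈ T ⊎ h ∈ S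
  ∈-inserts⁻ []      h∈S = inj₂ h∈S
  ∈-inserts⁻ (g ∷ T) h∈  with ∈-insert⁻ g h∈
  ... | inj₁ refl = inj₁ (here refl)
  ... | inj₂ h∈′  = Sum.map₁ there (∈-inserts⁻ T h∈′)

  inserts-unique : ∀ T {S} → Unique S → Unique (inserts T S)
  inserts-unique []      S-unique = S-unique
  inserts-unique (g ∷ T) S-unique = insert-unique g (inserts-unique T S-unique)

  length-inserts : ∀ T S → length (inserts T S) ≤ length T + length S
  length-inserts []      S = ≤-refl
  length-inserts (g ∷ T) S = ≤-trans (length-insert g (inserts T S)) (s≤s (length-inserts T S))

  potential-inserts : ∀ T S → potential S ≤ potential (inserts T S)
  potential-inserts []      S = ≤-refl
  potential-inserts (g ∷ T) S = ≤-trans (potential-inserts T S) (potential-insert g (inserts T S))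

  batch-bound : ∀ {S S′} → length S′ ≤ 4 + length S → suc (potential S) ≤ potential S′ →
                length S + 4 * n ≤ 4 * potential S → length S′ + 4 * n ≤ 4 * potential S′
  batch-bound {S} {S′} S′-size S′-closes S-bound = begin
    length S′ + 4 * n        ≤⟨ +-monoˡ-≤ (4 * n) S′-size ⟩
    (4 + length S) + 4 * n   ≡⟨ +-assoc 4 (length S) (4 * n) ⟩
    4 + (length S + 4 * n)   ≤⟨ +-monoʳ-≤ 4 S-bound ⟩
    4 + 4 * potential S      ≡⟨ *-suc 4 (potential S) ⟨
    4 * suc (potential S)    ≤⟨ *-monoʳ-≤ 4 S′-closes ⟩
    4 * potential S′         ∎

  data Walk (F : List (Edge n)) : ℕ → Fin n → Fin n → Set where
    []  : ∀ {s} → Walk F 0 s s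
    _∷_ : ∀ {k s w t} → Adj F s w → Walk F k w t → Walk F (suc k) s t

  Adj-sym : ∀ {F : List (Edge n)} {a b} → Adj F a b → Adj F b a
  Adj-sym = Sum.swap

  Adj-mono : ∀ {F H : List (Edge n)} {a b} → (∀ {g} → g ∈ F → g ∈ H) → Adj F a b → Adj H a b
  Adj-mono F⊆H = Sum.map F⊆H F⊆H

  Adj? : ∀ F a b → Dec (Adj F a b)
  Adj? F a b = ((a , b) ∈? F) ⊎-dec ((b , a) ∈? F)

  edge : ∀ {F a b} → Adj F a b → Edge n
  edge {a = a} {b} (inj₁ _) = a , b
  edge {a = a} {b} (inj₂ _) = b , a

  edge-∈ : ∀ {F a b} (ab : Adj F a b) → edge ab ∈ F
  edge-∈ (inj₁ ab∈F) = ab∈F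
  edge-∈ (inj₂ ba∈F) = ba∈F

  edge-Adj : ∀ {F S a b} (ab : Adj F a b) → edge ab ∈ S → Adj S a b
  edge-Adj (inj₁ _) = inj₁
  edge-Adj (inj₂ _) = inj₂

  walkEdges : ∀ {F k s t} → Walk F k s t → List (Edge n)
  walkEdges []      = []
  walkEdges (a ∷ p) = edge a ∷ walkEdges p

  walkEdges-∈ : ∀ {F k s t} (p : Walk F k s t) → All (_∈ F) (walkEdges p)
  walkEdges-∈ []      = []
  walkEdges-∈ (a ∷ p) = edge-∈ a ∷ walkEdges-∈ p

  length-walkEdges : ∀ {F k s t} (p : Walk F k s t) → length (walkEdges p) ≡ k
  length-walkEdges []      = refl
  length-walkEdges (a ∷ p) = cong suc (length-walkEdges p)

  walk-labelling : ∀ {F k s t S} (p : Walk F k s t) → All (_∈ S) (walkEdges p) →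
                   labelling S s ≡ labelling S t
  walk-labelling []      []            = refl
  walk-labelling (a ∷ p) (a∈S ∷ p⊆S) = trans (labelling-Adj (edge-Adj a a∈S)) (walk-labelling p p⊆S)

  walk? : ∀ F k s t → Dec (Walk F k s t)
  walk? F zero    s t = map′ (λ { refl → [] }) (λ { [] → refl }) (s ≟ t)
  walk? F (suc k) s t = map′ (λ (_ , a , p) → a ∷ p) (λ { (a ∷ p) → _ , a , p })
                             (any? (λ w → Adj? F s w ×-dec walk? F k w t))

  _without_ : List (Edge n) → Edge n → List (Edge n)
  F without e = filter (λ g → ¬? (g ≟ᴱ e)) F

  ∈-without⁻ : ∀ {F e g} → g ∈ F without e → g ∈ F × g ≢ e
  ∈-without⁻ {F} {e} = ∈-filter⁻ (λ g → ¬? (g ≟ᴱ e)) {xs = F}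

  avoid : ∀ {F a b c w} → Adj F c w → w ≢ a → w ≢ b → Adj (F without (a , b)) c w
  avoid (inj₁ cw∈F) w≢a w≢b = inj₁ (∈-filter⁺ (λ g → ¬? (g ≟ᴱ _)) cw∈F λ { refl → w≢b refl })
  avoid (inj₂ wc∈F) w≢a w≢b = inj₂ (∈-filter⁺ (λ g → ¬? (g ≟ᴱ _)) wc∈F λ { refl → w≢a refl })

  avoidˡ : ∀ {F a b c w} → Adj F w c → w ≢ a → w ≢ b → Adj (F without (a , b)) w c
  avoidˡ wc w≢a w≢b = Adj-sym (avoid (Adj-sym wc) w≢a w≢b)

  Univ-Adj : ∀ {F C c a b} → Univ F C c → StarEdge C c a b → Adj F a b
  Univ-Adj (_ , c-adj) (inj₁ (refl , b∈C , b≢c)) = c-adj _ b∈C b≢c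
  Univ-Adj (_ , c-adj) (inj₂ (refl , a∈C , a≢c)) = Adj-sym (c-adj _ a∈C a≢c)

  module _ (C₁ : Subset n) (c₁ : Fin n) (C₂ : Subset n) (c₂ : Fin n) where

    Hub : Fin n → Set
    Hub a = a ≡ c₁ ⊎ a ≡ c₂

    HEdge-hub : ∀ {a b} → HEdge C₁ c₁ C₂ c₂ a b → Hub a ⊎ Hub b
    HEdge-hub (inj₁ (inj₁ (a≡c₁ , _))) = inj₁ (inj₁ a≡c₁)
    HEdge-hub (inj₁ (inj₂ (b≡c₁ , _))) = inj₂ (inj₁ b≡c₁)
    HEdge-hub (inj₂ (inj₁ (a≡c₂ , _))) = inj₁ (inj₂ a≡c₂)
    HEdge-hub (inj₂ (inj₂ (b≡c₂ , _))) = inj₂ (inj₂ b≡c₂)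

    HEdge-Adj : ∀ {F a b} → Univ F C₁ c₁ → Univ F C₂ c₂ → HEdge C₁ c₁ C₂ c₂ a b → Adj F a b
    HEdge-Adj hub₁ _ (inj₁ star₁) = Univ-Adj hub₁ star₁
    HEdge-Adj _ hub₂ (inj₂ star₂) = Univ-Adj hub₂ star₂

    three-hubs : ∀ {x y z} → Hub x → Hub y → Hub z → x ≢ y → x ≢ z → y ≢ z → ⊥
    three-hubs (inj₁ refl) (inj₁ refl) _           x≢y _   _   = x≢y refl
    three-hubs (inj₂ refl) (inj₂ refl) _           x≢y _   _   = x≢y refl
    three-hubs (inj₁ refl) _           (inj₁ refl) _   x≢z _   = x≢z refl
    three-hubs (inj₂ refl) _           (inj₂ refl) _   x≢z _   = x≢z refl
    three-hubs _           (inj₁ refl) (inj₁ refl) _   _   y≢z = y≢z refl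
    three-hubs _           (inj₂ refl) (inj₂ refl) _   _   y≢z = y≢z refl

    hub-and-two-disjoint-edges : ∀ {x y y′ z z′} → Hub x → Hub y ⊎ Hub y′ → Hub z ⊎ Hub z′ →
                                 x ≢ y → x ≢ y′ → x ≢ z → x ≢ z′ →
                                 y ≢ z → y ≢ z′ → y′ ≢ z → y′ ≢ z′ → ⊥
    hub-and-two-disjoint-edges hx (inj₁ hy) (inj₁ hz) x≢y _ x≢z _ y≢z _ _ _ =
      three-hubs hx hy hz x≢y x≢z y≢z
    hub-and-two-disjoint-edges hx (inj₁ hy) (inj₂ hz) x≢y _ _ x≢z _ y≢z _ _ =
      three-hubs hx hy hz x≢y x≢z y≢z
    hub-and-two-disjoint-edges hx (inj₂ hy) (inj₁ hz) _ x≢y x≢z _ _ _ y≢z _ =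
      three-hubs hx hy hz x≢y x≢z y≢z
    hub-and-two-disjoint-edges hx (inj₂ hy) (inj₂ hz) _ x≢y _ x≢z _ _ _ y≢z =
      three-hubs hx hy hz x≢y x≢z y≢z

    two-star-cycle-length : ∀ vs → IsCycle (HEdge C₁ c₁ C₂ c₂) vs → length vs ≤ 4
    two-star-cycle-length [] (() , _)
    two-star-cycle-length (_ ∷ []) (s≤s () , _)
    two-star-cycle-length (_ ∷ _ ∷ []) (s≤s (s≤s ()) , _)
    two-star-cycle-length (_ ∷ _ ∷ _ ∷ []) _ = n≤1+n 3
    two-star-cycle-length (_ ∷ _ ∷ _ ∷ _ ∷ []) _ = ≤-refl
    two-star-cycle-length (a ∷ b ∷ c ∷ d ∷ e ∷ [])
      (_ , (a≢b ∷ a≢c ∷ a≢d ∷ a≢e ∷ []) ∷ (b≢c ∷ b≢d ∷ b≢e ∷ []) ∷ (c≢d ∷ c≢e ∷ [])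
             ∷ (d≢e ∷ []) ∷ [] ∷ []
         , ab ∷ bc ∷ cd ∷ de ∷ ea ∷ [])
      with HEdge-hub ab
    ... | inj₁ a-hub = ⊥-elim (hub-and-two-disjoint-edges a-hub (HEdge-hub bc) (HEdge-hub de)
                                 a≢b a≢c a≢d a≢e b≢d b≢e c≢d c≢e)
    ... | inj₂ b-hub = ⊥-elim (hub-and-two-disjoint-edges b-hub (HEdge-hub cd) (HEdge-hub ea)
                                 b≢c b≢d b≢e (≢-sym a≢b) c≢e (≢-sym a≢c) d≢e (≢-sym a≢d))
    two-star-cycle-length (a ∷ b ∷ c ∷ d ∷ e ∷ f ∷ _)
      (_ , (a≢b ∷ a≢c ∷ a≢d ∷ a≢e ∷ a≢f ∷ _) ∷ (b≢c ∷ b≢d ∷ b≢e ∷ b≢f ∷ _)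
             ∷ (c≢d ∷ c≢e ∷ c≢f ∷ _) ∷ (d≢e ∷ d≢f ∷ _) ∷ _
         , ab ∷ bc ∷ cd ∷ de ∷ ef ∷ _)
      with HEdge-hub ab
    ... | inj₁ a-hub = ⊥-elim (hub-and-two-disjoint-edges a-hub (HEdge-hub cd) (HEdge-hub ef)
                                 a≢c a≢d a≢e a≢f c≢e c≢f d≢e d≢f)
    ... | inj₂ b-hub = ⊥-elim (hub-and-two-disjoint-edges b-hub (HEdge-hub cd) (HEdge-hub ef)
                                 b≢c b≢d b≢e b≢f c≢e c≢f d≢e d≢f)

  module _ (E′ : List (Edge n)) where

    Short : Edge n → Set
    Short e = Σ[ k ∈ Fin 4 ] Walk (E′ without e) (toℕ k) (proj₂ e) (proj₁ e)

    short? : ∀ e → Dec (Short e)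
    short? e = any? (λ k → walk? (E′ without e) (toℕ k) (proj₂ e) (proj₁ e))

    extend : Edge n → List (Edge n) → List (Edge n)
    extend e S with e ∈? S | short? e
    ... | no _ | yes (_ , p) = e ∷ inserts (walkEdges p) S
    ... | _    | _           = S

    collect : List (Edge n) → List (Edge n)
    collect = foldr extend []

    record Invariant (S : List (Edge n)) : Set where
      field
        unique : Unique S
        ⊆E′    : S ⊆E E′
        bound  : length S + 4 * n ≤ 4 * potential S

    open Invariant

    extend-invariant : ∀ {e S} → e ∈ E′ → Invariant S → Invariant (extend e S)
    extend-invariant {e} {S} e∈E′ inv with e ∈? S | short? e
    ... | yes _   | _           = inv
    ... | no  _   | no  _       = inv
    ... | no  e∉S | yes (k , p) = record
      { unique = ¬Any⇒All¬ T e∉T ∷ inserts-unique (walkEdges p) (unique inv)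
      ; ⊆E′    = e∈E′ ∷ All.tabulate (λ h∈T →
                   [ proj₁ ∘ on-walk , All.lookup (⊆E′ inv) ] (∈-inserts⁻ (walkEdges p) h∈T))
      ; bound  = batch-bound {S} {e ∷ T} (s≤s T-size) closes (bound inv)
      }
      where
      T : List (Edge n)
      T = inserts (walkEdges p) S
      on-walk : ∀ {h} → h ∈ walkEdges p → h ∈ E′ × h ≢ e
      on-walk = ∈-without⁻ {E′} ∘ All.lookup (walkEdges-∈ p)
      e∉T : e ∉ T
      e∉T e∈T with ∈-inserts⁻ (walkEdges p) e∈T
      ... | inj₁ e∈p = proj₂ (on-walk e∈p) refl
      ... | inj₂ e∈S = e∉S e∈S
      T-size : length T ≤ 3 + length S
      T-size = ≤-trans (length-inserts (walkEdges p) S)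
        (+-monoˡ-≤ (length S) (≤-trans (≤-reflexive (length-walkEdges p)) (toℕ≤pred[n] k)))
      closes : suc (potential S) ≤ potential (e ∷ T)
      closes = ≤-trans (s≤s (potential-inserts (walkEdges p) S))
        (potential-∷-closing T (sym (walk-labelling p (All.tabulate (∈-inserts⁺ˡ {walkEdges p})))))

    extend-⊇ : ∀ e {S h} → h ∈ S → h ∈ extend e S
    extend-⊇ e {S} h∈S with e ∈? S | short? e
    ... | yes _ | _           = h∈S
    ... | no  _ | no  _       = h∈S
    ... | no  _ | yes (_ , p) = there (∈-inserts⁺ʳ (walkEdges p) h∈S)

    extend-∋ : ∀ {e} S → Short e → e ∈ extend e S
    extend-∋ {e} S e-short with e ∈? S | short? e
    ... | yes e∈S | _          = e∈S
    ... | no  _   | no  ¬short = contradiction e-short ¬short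
    ... | no  _   | yes _      = here refl

    collect-invariant : ∀ {L} → L ⊆E E′ → Invariant (collect L)
    collect-invariant [] =
      record { unique = [] ; ⊆E′ = [] ; bound = *-monoʳ-≤ 4 potential-[] }
    collect-invariant (e∈E′ ∷ L⊆E′) =
      extend-invariant e∈E′ (collect-invariant L⊆E′)

    collect-∋ : ∀ {L e} → e ∈ L → Short e → e ∈ collect L
    collect-∋ {e ∷ L} (here refl) = extend-∋ (collect L)
    collect-∋ {g ∷ L} (there e∈L) = extend-⊇ g ∘ collect-∋ e∈L

    cover : List (Edge n)
    cover = collect E′

    cover-invariant : Invariant cover
    cover-invariant = collect-invariant (All.tabulate id)

    Adj-covered : ∀ {a b} → Adj E′ a b → Short (a , b) → Short (b , a) → Adj cover a b
    Adj-covered (inj₁ ab∈E′) ab-short _ = inj₁ (collect-∋ ab∈E′ ab-short)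
    Adj-covered (inj₂ ba∈E′) _ ba-short = inj₂ (collect-∋ ba∈E′ ba-short)

    triangle-short : ∀ {a b c} → Adj E′ b c → Adj E′ c a → c ≢ a → c ≢ b → Short (a , b)
    triangle-short bc ca c≢a c≢b = # 2 , avoid bc c≢a c≢b ∷ avoidˡ ca c≢a c≢b ∷ []

    square-short : ∀ {a b c d} → Adj E′ b c → Adj E′ c d → Adj E′ d a →
                   c ≢ a → c ≢ b → d ≢ a → d ≢ b → Short (a , b)
    square-short bc cd da c≢a c≢b d≢a d≢b =
      # 3 , avoid bc c≢a c≢b ∷ avoidˡ cd c≢a c≢b ∷ avoidˡ da d≢a d≢b ∷ []

    triangle-covered : ∀ {a b c} → Adj E′ a b → Adj E′ b c → Adj E′ c a →
                       c ≢ a → c ≢ b → Adj cover a b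
    triangle-covered ab bc ca c≢a c≢b = Adj-covered ab
      (triangle-short bc ca c≢a c≢b)
      (triangle-short (Adj-sym ca) (Adj-sym bc) c≢b c≢a)

    square-covered : ∀ {a b c d} → Adj E′ a b → Adj E′ b c → Adj E′ c d → Adj E′ d a →
                     c ≢ a → c ≢ b → d ≢ a → d ≢ b → Adj cover a b
    square-covered ab bc cd da c≢a c≢b d≢a d≢b = Adj-covered ab
      (square-short bc cd da c≢a c≢b d≢a d≢b)
      (square-short (Adj-sym da) (Adj-sym cd) (Adj-sym bc) d≢b d≢a c≢b c≢a)

    short-cycle-covered : ∀ vs → IsCycle (Adj E′) vs → length vs ≤ 4 → CycleEdgesIn cover vs
    short-cycle-covered [] (() , _) _
    short-cycle-covered (_ ∷ []) (s≤s () , _) _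
    short-cycle-covered (_ ∷ _ ∷ []) (s≤s (s≤s ()) , _) _
    short-cycle-covered (a ∷ b ∷ c ∷ [])
      (_ , (a≢b ∷ a≢c ∷ []) ∷ (b≢c ∷ []) ∷ [] ∷ [] , ab ∷ bc ∷ ca ∷ []) _ =
        triangle-covered ab bc ca (≢-sym a≢c) (≢-sym b≢c)
      ∷ triangle-covered bc ca ab a≢b a≢c
      ∷ triangle-covered ca ab bc b≢c (≢-sym a≢b)
      ∷ []
    short-cycle-covered (a ∷ b ∷ c ∷ d ∷ [])
      (_ , (a≢b ∷ a≢c ∷ a≢d ∷ []) ∷ (b≢c ∷ b≢d ∷ []) ∷ (c≢d ∷ []) ∷ [] ∷ []
         , ab ∷ bc ∷ cd ∷ da ∷ []) _ =
        square-covered ab bc cd da (≢-sym a≢c) (≢-sym b≢c) (≢-sym a≢d) (≢-sym b≢d)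
      ∷ square-covered bc cd da ab (≢-sym b≢d) (≢-sym c≢d) a≢b a≢c
      ∷ square-covered cd da ab bc a≢c a≢d b≢c b≢d
      ∷ square-covered da ab bc cd b≢d (≢-sym a≢b) c≢d (≢-sym a≢c)
      ∷ []
    short-cycle-covered (_ ∷ _ ∷ _ ∷ _ ∷ _ ∷ _) _ (s≤s (s≤s (s≤s (s≤s ()))))

    local-cycle-covered : ∀ {𝒞} vs → IsLocalCycle 𝒞 E′ vs → CycleEdgesIn cover vs
    local-cycle-covered vs
      (C₁ , C₂ , c₁ , c₂ , _ , _ , _ , hub₁ , hub₂ , cycle@(long , distinct , steps)) =
      short-cycle-covered vs
        (long , distinct , All.map (HEdge-Adj C₁ c₁ C₂ c₂ hub₁ hub₂) steps)
        (two-star-cycle-length C₁ c₁ C₂ c₂ vs cycle)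

    potential-bound : ∀ {𝒞 x S} → NumComponents 𝒞 x → All (λ C → ∃[ c ] Univ E′ C c) 𝒞 →
                      Unique S → S ⊆E E′ → potential S ≤ x + length E′
    potential-bound {𝒞} {x} {S} (f , f-onto , f-components) hubs S-unique S⊆E′ = begin
      potential S                               ≤⟨ potential-inserts E′ S ⟩
      length (roots (labelling S̄)) + length S̄   ≤⟨ +-mono-≤ roots≤x S̄≤E′ ⟩
      x + length E′                             ∎
      where
      S̄ : List (Edge n)
      S̄ = inserts E′ S
      same-label : ∀ {u v} → HConn 𝒞 u v → labelling S̄ u ≡ labelling S̄ v
      same-label = HConn⇒same-label (labelling S̄)
                     (labelling-Adj ∘ Adj-mono (∈-inserts⁺ˡ {E′})) hubs
      roots≤x : length (roots (labelling S̄)) ≤ x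
      roots≤x = length-roots≤ (labelling S̄) f f-onto
                  λ {u} {v} → same-label ∘ Equivalence.to (f-components u v)
      S̄≤E′ : length S̄ ≤ length E′
      S̄≤E′ = Unique⇒length≤ _≟ᴱ_ (inserts-unique E′ S-unique)
               λ h∈S̄ → [ id , All.lookup S⊆E′ ] (∈-inserts⁻ E′ h∈S̄)

    cover-size : ∀ {𝒞 x ℓ} → NumComponents 𝒞 x → All (λ C → ∃[ c ] Univ E′ C c) 𝒞 →
                 length E′ ≤ ℓ → length cover + 4 * n ≤ 4 * (ℓ + x)
    cover-size {x = x} {ℓ} components hubs |E′|≤ℓ = begin
      length cover + 4 * n   ≤⟨ bound cover-invariant ⟩
      4 * potential cover    ≤⟨ *-monoʳ-≤ 4 (potential-bound components hubs
                                               (unique cover-invariant) (⊆E′ cover-invariant)) ⟩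
      4 * (x + length E′)    ≤⟨ *-monoʳ-≤ 4 (+-monoʳ-≤ x |E′|≤ℓ) ⟩
      4 * (x + ℓ)            ≡⟨ cong (4 *_) (+-comm x ℓ) ⟩
      4 * (ℓ + x)            ∎

open import Data.Integer using (ℤ; +_; _-_; _+_; _*_; _≤_; _⊖_; +≤+)
open import Data.Rational using (ℚ; 0ℚ; _<_)
open import Data.Integer.Properties using (⊖-≥; m-n≡m⊖n; pos-*; module ≤-Reasoning)
open import Data.Integer.Tactic.RingSolver using (solve-∀)
import Data.Nat as ℕ
import Data.Nat.Properties as ℕ

bound-in-ℤ : ∀ {s} n ℓ x → s ℕ.+ 4 ℕ.* n ℕ.≤ 4 ℕ.* (ℓ ℕ.+ x) → + s ≤ + 4 * ((+ ℓ - + n) + + x)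
bound-in-ℤ {s} n ℓ x s+4n≤4[ℓ+x] = begin
  + s                                  ≤⟨ +≤+ (ℕ.m+n≤o⇒m≤o∸n s s+4n≤4[ℓ+x]) ⟩
  + (4 ℕ.* (ℓ ℕ.+ x) ℕ.∸ 4 ℕ.* n)     ≡⟨ ⊖-≥ (ℕ.≤-trans (ℕ.m≤n+m (4 ℕ.* n) s) s+4n≤4[ℓ+x]) ⟨
  4 ℕ.* (ℓ ℕ.+ x) ⊖ 4 ℕ.* n            ≡⟨ m-n≡m⊖n (4 ℕ.* (ℓ ℕ.+ x)) (4 ℕ.* n) ⟨
  + (4 ℕ.* (ℓ ℕ.+ x)) - + (4 ℕ.* n)   ≡⟨ cong₂ _-_ (pos-* 4 (ℓ ℕ.+ x)) (pos-* 4 n) ⟩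
  + 4 * (+ ℓ + + x) - + 4 * + n        ≡⟨ distribute (+ ℓ) (+ n) (+ x) ⟩
  + 4 * ((+ ℓ - + n) + + x)            ∎
  where
  open ≤-Reasoning
  distribute : ∀ (l m y : ℤ) → + 4 * (l + y) - + 4 * m ≡ + 4 * ((l - m) + y)
  distribute = solve-∀

lemma18 : ∀ {n} (G : Graph n) (𝒞 : List (Subset n)) (ω : Edge n → ℚ) (ℓ : ℕ) (b : ℚ)
          → All (λ e → 0ℚ < ω e) (Graph.E G) → 0ℚ < b
          → (x : ℕ) → NumComponents 𝒞 x
          → IsYes G 𝒞 ω ℓ b
          → ∀ E′ → IsOptimal G 𝒞 ω ℓ b E′
          → ∃[ E* ] (E* ⊆E E′ × Unique E*
              × + length E* ≤ + 4 * ((+ ℓ - + n) + + x)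
              × ∀ vs → IsLocalCycle 𝒞 E′ vs → CycleEdgesIn E* vs)
lemma18 {n} G 𝒞 ω ℓ b _ _ x components _ E′ ((_ , _ , |E′|≤ℓ , _ , hubs) , _) =
  cover E′ , ⊆E′ , unique , bound-in-ℤ n ℓ x (cover-size E′ components hubs |E′|≤ℓ) ,
  local-cycle-covered E′
  where open Invariant (cover-invariant E′)
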